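{- Let $r,t$ be odd positive integers with $r\ge 2$ and $\gcd(r,t-2)=1$. Then the Doob graph $G(r,t)$ is not an open XOR-magic graph.
   Context: For $N\ge 3$ and a set $S$ of positive integers, the circulant graph $C_N(S)$ has vertices $x_0,\ldots,x_{N-1}$, with distinct $x_i,x_j$ adjacent iff $|i-j|\in\{s,\,N-s: s\in S\}$. For positive integers $r\ge 2$ and $t$, the Doob graph is $G(r,t)=C_N(\{kt+1 : 0\le k\le \lfloor (r-1)t/2\rfloor\})$ where $N=(r-1)t+2$. For a vertex $x$, $N(x)$ is its set of neighbours. A simple connected graph $G=(V,E)$ is an open XOR-magic graph if $|V|=2^p$ for some positive integer $p$ and there is a bijection $\ell:V\to(\mathbb{Z}_2)^p$ with $\sum_{y\in N(x)}\ell(y)=0$ in $(\mathbb{Z}_2)^p$ for every $x\in V$. -}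

module Defs where

open import Data.Nat using (ℕ; zero; suc; _+_; _*_; _∸_; _≤_; _^_; ∣_-_∣; _/_; _%_)
open import Data.Nat.Properties using (_≟_)
open import Data.Fin using (Fin; toℕ)
import Data.Fin.Properties as FinP
open import Data.Bool using (Bool; false; _xor_)
open import Data.Vec using (Vec; zipWith; replicate)
open import Data.List using (List; map; upTo; foldr; allFin)
open import Data.List.Relation.Unary.Any using (Any; any?)
open import Data.Product using (Σ; _×_; _,_)
open import Data.Sum using (_⊎_)
open import Data.Sum.Relation.Unary.All using ()
open import Relation.Binary.PropositionalEquality using (_≡_; _≢_)
open import Relation.Nullary using (Dec; yes; no; ¬_)
open import Relation.Nullary.Decidable using (_×-dec_; _⊎-dec_; ¬?)
open import Function.Definitions using (Bijective)

Z2^ : ℕ → Set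
Z2^ p = Vec Bool p

_⊕_ : ∀ {p} → Z2^ p → Z2^ p → Z2^ p
_⊕_ = zipWith _xor_

𝟘 : ∀ {p} → Z2^ p
𝟘 = replicate _ false

CircAdj : (N : ℕ) → List ℕ → Fin N → Fin N → Set
CircAdj N S i j =
  (i ≢ j) × Any (λ s → (∣ toℕ i - toℕ j ∣ ≡ s) ⊎ (∣ toℕ i - toℕ j ∣ ≡ N ∸ s)) S

circAdj? : (N : ℕ) (S : List ℕ) (i j : Fin N) → Dec (CircAdj N S i j)
circAdj? N S i j =
  ¬? (i FinP.≟ j) ×-dec
  any? (λ s → (∣ toℕ i - toℕ j ∣ ≟ s) ⊎-dec (∣ toℕ i - toℕ j ∣ ≟ N ∸ s)) S

doobN : ℕ → ℕ → ℕ
doobN r t = (r ∸ 1) * t + 2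

doobS : ℕ → ℕ → List ℕ
doobS r t = map (λ k → k * t + 1) (upTo (((r ∸ 1) * t) / 2 + 1))

DoobAdj : (r t : ℕ) → Fin (doobN r t) → Fin (doobN r t) → Set
DoobAdj r t = CircAdj (doobN r t) (doobS r t)

doobAdj? : (r t : ℕ) (i j : Fin (doobN r t)) → Dec (DoobAdj r t i j)
doobAdj? r t = circAdj? (doobN r t) (doobS r t)

data Reachable {n : ℕ} (Adj : Fin n → Fin n → Set) : Fin n → Fin n → Set where
  here : ∀ {x} → Reachable Adj x x
  step : ∀ {x y z} → Adj x y → Reachable Adj y z → Reachable Adj x z

Connected : {n : ℕ} → (Fin n → Fin n → Set) → Set
Connected {n} Adj = ∀ (x y : Fin n) → Reachable Adj x y

neighbourSum : {n p : ℕ} (Adj : Fin n → Fin n → Set)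
  → (∀ x y → Dec (Adj x y)) → (Fin n → Z2^ p) → Fin n → Z2^ p
neighbourSum {n} Adj adj? ℓ x = foldr add 𝟘 (allFin n)
  where
  add : Fin n → _ → _
  add y acc with adj? x y
  ... | yes _ = ℓ y ⊕ acc
  ... | no  _ = acc

OpenXORMagic : {n : ℕ} (Adj : Fin n → Fin n → Set) → (∀ x y → Dec (Adj x y)) → Set
OpenXORMagic {n} Adj adj? =
  Connected Adj ×
  Σ ℕ λ p → (1 ≤ p) × (n ≡ 2 ^ p) ×
    Σ (Fin n → Z2^ p) λ ℓ → Bijective _≡_ _≡_ ℓ ×
      (∀ x → neighbourSum Adj adj? ℓ x ≡ 𝟘)

-- Adding the vanishing neighbour sums of an open XOR-magic labelling ℓ at two
-- vertices u, v cancels every label on N(u) ∩ N(v), so the labels on N(u) △ N(v)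
-- sum to 0; if N(u) △ N(v) = {a, b} with a ≠ b this forces ℓ a = ℓ b, contradicting
-- injectivity. In G(r,t) the distance set S ∪ (N − S) is exactly {m t + 1 : m ≤ r − 1},
-- so x_y ~ x_0 iff y = m t + 1 and x_y ~ x_t iff |t − y| = m t + 1 for some m.
-- Hence N(x_0) △ N(x_t) = {x_1, x_{t−1}}, and these are distinct since t ≠ 2.
{-# OPTIONS --safe #-}
module Submission where

open import Defs
open import Algebra.Bundles using (AbelianGroup; CommutativeMonoid)
open import Algebra.Structures using (IsAbelianGroup)
open import Data.Bool.Properties using (xor-assoc; xor-comm; xor-identityˡ; xor-identityʳ; xor-same)
open import Data.Fin using (Fin; zero; suc; toℕ; fromℕ<; punchIn; punchOut)
open import Data.Fin.Properties using (toℕ<n; toℕ-injective; toℕ-fromℕ<; punchIn-punchOut; punchInᵢ≢i; punchIn-injective)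
open import Data.Integer using (+_; _-_)
open import Data.Integer.GCD using (gcd)
open import Data.List using (foldr; tabulate; allFin; upTo)
open import Data.List.Properties using (foldr-cong)
open import Data.List.Relation.Unary.Any using (Any; satisfied)
import Data.List.Relation.Unary.Any.Properties as AnyP
open import Data.List.Membership.Propositional using (lose)
open import Data.List.Membership.Propositional.Properties using (∈-upTo⁺)
open import Data.Nat using (ℕ; zero; suc; _+_; _*_; _∸_; _≤_; _<_; _%_; _/_; ∣_-_∣; z≤n; s≤s; s≤s⁻¹; z<s; >-nonZero)
open import Data.Nat.Properties
open import Data.Nat.DivMod using (m≡m%n+[m/n]*n; m%n<n)
open import Data.Nat.Solver using (module +-*-Solver)
open +-*-Solver using (solve; _:+_; _:*_; _:=_; con)
open import Data.Vec using ([]; _∷_)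
open import Data.Vec.Functional using (Vector; removeAt)
open import Data.Vec.Properties using (zipWith-assoc; zipWith-comm; zipWith-identityˡ; zipWith-identityʳ)
open import Data.Product using (∃-syntax; _×_; _,_; proj₁)
open import Data.Sum using (_⊎_; inj₁; inj₂)
open import Function using (id; _∘_; _⇔_; mk⇔; Equivalence)
open import Function.Construct.Composition using (_⇔-∘_)
open import Function.Construct.Symmetry using (⇔-sym)
open import Level using (0ℓ)
open import Relation.Binary.PropositionalEquality
  using (_≡_; _≢_; refl; sym; trans; cong; cong₂; subst; isEquivalence; module ≡-Reasoning)
open import Relation.Nullary using (¬_; Dec; yes; no; contradiction)

⊕-self : ∀ {p} (u : Z2^ p) → u ⊕ u ≡ 𝟘
⊕-self []      = refl
⊕-self (x ∷ u) = cong₂ _∷_ (xor-same x) (⊕-self u)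

⊕-identityˡ : ∀ {p} (u : Z2^ p) → 𝟘 ⊕ u ≡ u
⊕-identityˡ = zipWith-identityˡ xor-identityˡ

⊕-identityʳ : ∀ {p} (u : Z2^ p) → u ⊕ 𝟘 ≡ u
⊕-identityʳ = zipWith-identityʳ xor-identityʳ

⊕-𝟘-isAbelianGroup : ∀ {p} → IsAbelianGroup _≡_ (_⊕_ {p}) 𝟘 id
⊕-𝟘-isAbelianGroup = record
  { isGroup = record
    { isMonoid = record
      { isSemigroup = record
        { isMagma = record { isEquivalence = isEquivalence ; ∙-cong = cong₂ _⊕_ }
        ; assoc = zipWith-assoc xor-assoc
        }
      ; identity = ⊕-identityˡ , ⊕-identityʳ
      }
    ; inverse = ⊕-self , ⊕-self
    ; ⁻¹-cong = id
    }
  ; comm = zipWith-comm xor-comm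
  }

⊕-𝟘-abelianGroup : ℕ → AbelianGroup 0ℓ 0ℓ
⊕-𝟘-abelianGroup p = record { isAbelianGroup = ⊕-𝟘-isAbelianGroup {p} }

module MonoidSum {c ℓ} (M : CommutativeMonoid c ℓ) where
  open CommutativeMonoid M using (Carrier; _≈_; _∙_; ε; ∙-congˡ; identityʳ)
  open import Algebra.Properties.CommutativeMonoid.Sum M using (sum; sum-cong-≋; sum-replicate-zero; sum-remove)
  open import Relation.Binary.Reasoning.Setoid (CommutativeMonoid.setoid M)

  foldr-tabulate≡sum : ∀ {a} {A : Set a} {m} (g : A → Carrier) (h : Fin m → A) →
    foldr (λ y → g y ∙_) ε (tabulate h) ≡ sum (g ∘ h)
  foldr-tabulate≡sum {m = zero}  g h = refl
  foldr-tabulate≡sum {m = suc m} g h = cong (g (h zero) ∙_) (foldr-tabulate≡sum g (h ∘ suc))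

  sum-zero : ∀ {n} (f : Vector Carrier n) → (∀ i → f i ≈ ε) → sum f ≈ ε
  sum-zero {n} f f≈0 = begin
    sum f              ≈⟨ sum-cong-≋ f≈0 ⟩
    sum {n} (λ _ → ε)  ≈⟨ sum-replicate-zero n ⟩
    ε                  ∎

  sum-supported-at : ∀ {n} (f : Vector Carrier n) i → (∀ j → j ≢ i → f j ≈ ε) → sum f ≈ f i
  sum-supported-at {suc n} f i f≈0 = begin
    sum f                     ≈⟨ sum-remove f ⟩
    f i ∙ sum (removeAt f i)  ≈⟨ ∙-congˡ (sum-zero _ (λ j → f≈0 (punchIn i j) (punchInᵢ≢i i j))) ⟩
    f i ∙ ε                   ≈⟨ identityʳ (f i) ⟩
    f i                       ∎

  sum-supported-at-pair : ∀ {n} (f : Vector Carrier n) {i j} → i ≢ j →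
    (∀ k → k ≢ i → k ≢ j → f k ≈ ε) → sum f ≈ f i ∙ f j
  sum-supported-at-pair {suc n} f {i} {j} i≢j f≈0 = begin
    sum f                              ≈⟨ sum-remove f ⟩
    f i ∙ sum (removeAt f i)           ≈⟨ ∙-congˡ (sum-supported-at (removeAt f i) (punchOut i≢j) off-j) ⟩
    f i ∙ f (punchIn i (punchOut i≢j)) ≡⟨ cong (λ k → f i ∙ f k) (punchIn-punchOut i≢j) ⟩
    f i ∙ f j                          ∎
    where
    off-j : ∀ k → k ≢ punchOut i≢j → f (punchIn i k) ≈ ε
    off-j k k≢ = f≈0 (punchIn i k) (punchInᵢ≢i i k)
      (λ e → k≢ (punchIn-injective i k _ (trans e (sym (punchIn-punchOut i≢j)))))

onlyIf : ∀ {p} {A : Set} → Dec A → Z2^ p → Z2^ p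
onlyIf (yes _) v = v
onlyIf (no _)  v = 𝟘

onlyIf-⇔ : ∀ {p} {A B : Set} (d : Dec A) (e : Dec B) (v : Z2^ p) → A ⇔ B → onlyIf d v ⊕ onlyIf e v ≡ 𝟘
onlyIf-⇔ (yes _) (yes _) v _   = ⊕-self v
onlyIf-⇔ (no _)  (no _)  v _   = ⊕-self 𝟘
onlyIf-⇔ (yes a) (no ¬b) v A⇔B = contradiction (Equivalence.to A⇔B a) ¬b
onlyIf-⇔ (no ¬a) (yes b) v A⇔B = contradiction (Equivalence.from A⇔B b) ¬a

ExactlyOne : Set → Set → Set
ExactlyOne A B = (A × ¬ B) ⊎ (¬ A × B)

onlyIf-exactlyOne : ∀ {p} {A B : Set} (d : Dec A) (e : Dec B) (v : Z2^ p) →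
  ExactlyOne A B → onlyIf d v ⊕ onlyIf e v ≡ v
onlyIf-exactlyOne (yes _) (no _)  v _                = ⊕-identityʳ v
onlyIf-exactlyOne (no _)  (yes _) v _                = ⊕-identityˡ v
onlyIf-exactlyOne (yes _) (yes b) v (inj₁ (_ , ¬b)) = contradiction b ¬b
onlyIf-exactlyOne (yes a) (yes _) v (inj₂ (¬a , _)) = contradiction a ¬a
onlyIf-exactlyOne (no ¬a) (no _)  v (inj₁ (a , _))  = contradiction a ¬a
onlyIf-exactlyOne (no _)  (no ¬b) v (inj₂ (_ , b))  = contradiction b ¬b

module _ {n p : ℕ} (Adj : Fin n → Fin n → Set) (adj? : ∀ x y → Dec (Adj x y)) (ℓ : Fin n → Z2^ p) where
  open AbelianGroup (⊕-𝟘-abelianGroup p) using (commutativeMonoid; group)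
  open import Algebra.Properties.Group group using (inverseˡ-unique)
  open import Algebra.Properties.CommutativeMonoid.Sum commutativeMonoid using (sum; ∑-distrib-+)
  open MonoidSum commutativeMonoid using (foldr-tabulate≡sum; sum-supported-at-pair)

  private
    -- The step function of the fold in neighbourSum is local to Defs; unification names it.
    neighbourStep : ∀ x → ∃[ step ] neighbourSum Adj adj? ℓ x ≡ foldr step 𝟘 (allFin n)
    neighbourStep x = _ , refl

    neighbourStep-onlyIf : ∀ x y acc → proj₁ (neighbourStep x) y acc ≡ onlyIf (adj? x y) (ℓ y) ⊕ acc
    neighbourStep-onlyIf x y acc with adj? x y
    ... | yes _ = refl
    ... | no  _ = sym (⊕-identityˡ acc)

  neighbourSum≡sum : ∀ x → neighbourSum Adj adj? ℓ x ≡ sum (λ y → onlyIf (adj? x y) (ℓ y))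
  neighbourSum≡sum x =
    trans (foldr-cong (neighbourStep-onlyIf x) refl (allFin n))
          (foldr-tabulate≡sum (λ y → onlyIf (adj? x y) (ℓ y)) id)

  neighbourSums-vanish⇒ℓ-collide : (∀ x → neighbourSum Adj adj? ℓ x ≡ 𝟘) →
    ∀ {u v a b} → a ≢ b → ExactlyOne (Adj u a) (Adj v a) → ExactlyOne (Adj u b) (Adj v b) →
    (∀ y → y ≢ a → y ≢ b → Adj u y ⇔ Adj v y) → ℓ a ≡ ℓ b
  neighbourSums-vanish⇒ℓ-collide magic {u} {v} {a} {b} a≢b a-separates b-separates others-agree =
    inverseˡ-unique (ℓ a) (ℓ b) (begin
      ℓ a ⊕ ℓ b                        ≡⟨ cong₂ _⊕_ (onlyIf-exactlyOne (adj? u a) (adj? v a) (ℓ a) a-separates)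
                                                      (onlyIf-exactlyOne (adj? u b) (adj? v b) (ℓ b) b-separates) ⟨
      g a ⊕ g b                        ≡⟨ sum-supported-at-pair g a≢b g-vanishes ⟨
      sum g                            ≡⟨ ∑-distrib-+ Nu Nv ⟩
      sum Nu ⊕ sum Nv                  ≡⟨ cong₂ _⊕_ (neighbourSum≡sum u) (neighbourSum≡sum v) ⟨
      neighbourSum Adj adj? ℓ u ⊕ neighbourSum Adj adj? ℓ v  ≡⟨ cong₂ _⊕_ (magic u) (magic v) ⟩
      𝟘 ⊕ 𝟘                            ≡⟨ ⊕-self 𝟘 ⟩
      𝟘                                ∎)
    where
    open ≡-Reasoning
    Nu Nv g : Fin n → Z2^ p
    Nu y = onlyIf (adj? u y) (ℓ y)
    Nv y = onlyIf (adj? v y) (ℓ y)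
    g y = Nu y ⊕ Nv y
    g-vanishes : ∀ y → y ≢ a → y ≢ b → g y ≡ 𝟘
    g-vanishes y y≢a y≢b = onlyIf-⇔ (adj? u y) (adj? v y) (ℓ y) (others-agree y y≢a y≢b)

OneMod : ℕ → ℕ → Set
OneMod t d = ∃[ m ] d ≡ m * t + 1

m*t+2∸[n*t+1]≡[m∸n]*t+1 : ∀ {m n} t → n ≤ m → m * t + 2 ∸ (n * t + 1) ≡ (m ∸ n) * t + 1
m*t+2∸[n*t+1]≡[m∸n]*t+1 {m} {n} t n≤m = begin
  m * t + 2 ∸ (n * t + 1)                   ≡⟨ cong (λ k → k * t + 2 ∸ (n * t + 1)) (m+[n∸m]≡n n≤m) ⟨
  (n + j) * t + 2 ∸ (n * t + 1)             ≡⟨ cong (_∸ (n * t + 1)) (solve 3 (λ n j t →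
                                                 (n :+ j) :* t :+ con 2 := (n :* t :+ con 1) :+ (j :* t :+ con 1))
                                                 refl n j t) ⟩
  (n * t + 1) + (j * t + 1) ∸ (n * t + 1)   ≡⟨ m+n∸m≡n (n * t + 1) (j * t + 1) ⟩
  j * t + 1                                 ∎
  where
  open ≡-Reasoning
  j : ℕ
  j = m ∸ n

m<n⇒m*t+2≤n*t+1 : ∀ {m n t} → 1 ≤ t → m < n → m * t + 2 ≤ n * t + 1
m<n⇒m*t+2≤n*t+1 {m} {n} {t} t≥1 m<n = begin
  m * t + 2        ≤⟨ +-monoʳ-≤ (m * t) (+-monoˡ-≤ 1 t≥1) ⟩
  m * t + (t + 1)  ≡⟨ sym (+-assoc (m * t) t 1) ⟩
  m * t + t + 1    ≡⟨ cong (_+ 1) (+-comm (m * t) t) ⟩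
  suc m * t + 1    ≤⟨ +-monoˡ-≤ 1 (*-monoˡ-≤ t m<n) ⟩
  n * t + 1        ∎
  where open ≤-Reasoning

m≤m/2+[1+m/2] : ∀ m → m ≤ m / 2 + suc (m / 2)
m≤m/2+[1+m/2] m = begin
  m                  ≡⟨ m≡m%n+[m/n]*n m 2 ⟩
  m % 2 + m / 2 * 2  ≤⟨ +-monoˡ-≤ (m / 2 * 2) (s≤s⁻¹ (m%n<n m 2)) ⟩
  1 + m / 2 * 2      ≡⟨ solve 1 (λ h → con 1 :+ h :* con 2 := h :+ (con 1 :+ h)) refl (m / 2) ⟩
  m / 2 + suc (m / 2) ∎
  where open ≤-Reasoning

∣toℕ-toℕ∣<n : ∀ {n} (i j : Fin n) → ∣ toℕ i - toℕ j ∣ < n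
∣toℕ-toℕ∣<n i j = ≤-<-trans (∣m-n∣≤m⊔n (toℕ i) (toℕ j)) (⊔-pres-<m (toℕ<n i) (toℕ<n j))

doobAdj⇒oneMod : ∀ r {t} {i j : Fin (doobN r t)} → 1 ≤ t → DoobAdj r t i j → OneMod t ∣ toℕ i - toℕ j ∣
doobAdj⇒oneMod r {t} {i} {j} t≥1 (i≢j , d∈S) with satisfied (AnyP.map⁻ d∈S)
... | k , inj₁ d≡s = k , d≡s
... | k , inj₂ d≡N∸s with k ≤? r ∸ 1
...   | yes k≤R = r ∸ 1 ∸ k , trans d≡N∸s (m*t+2∸[n*t+1]≡[m∸n]*t+1 t k≤R)
...   | no  k≰R = contradiction (toℕ-injective (∣m-n∣≡0⇒m≡n d≡0)) i≢j
  where
  d≡0 : ∣ toℕ i - toℕ j ∣ ≡ 0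
  d≡0 = trans d≡N∸s (m≤n⇒m∸n≡0 (m<n⇒m*t+2≤n*t+1 t≥1 (≰⇒> k≰R)))

oneMod⇒doobAdj : ∀ r {t} {i j : Fin (doobN r t)} → 1 ≤ t → OneMod t ∣ toℕ i - toℕ j ∣ → DoobAdj r t i j
oneMod⇒doobAdj r {t} {i} {j} t≥1 (m , d≡) = i≢j , AnyP.map⁺ d∈S
  where
  R K : ℕ
  R = r ∸ 1
  K = R * t / 2
  i≢j : i ≢ j
  i≢j refl = m+1+n≢0 (m * t) (trans (sym d≡) (∣n-n∣≡0 (toℕ i)))
  m≤R : m ≤ R
  m≤R = ≮⇒≥ λ R<m → ≤⇒≯ (m<n⇒m*t+2≤n*t+1 t≥1 R<m) (subst (_< doobN r t) d≡ (∣toℕ-toℕ∣<n i j))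
  d∈S : Any (λ k → (∣ toℕ i - toℕ j ∣ ≡ k * t + 1) ⊎ (∣ toℕ i - toℕ j ∣ ≡ doobN r t ∸ (k * t + 1)))
            (upTo (K + 1))
  -- S only lists the jumps k t + 1 with k ≤ K; a longer jump is N − s for s = (R − m) t + 1.
  d∈S with m ≤? K
  ... | yes m≤K = lose (∈-upTo⁺ (≤-<-trans m≤K (m<m+n K z<s))) (inj₁ d≡)
  ... | no  m≰K = lose (∈-upTo⁺ (≤-<-trans R∸m≤K (m<m+n K z<s))) (inj₂ (trans d≡ (sym N∸[R∸m]≡)))
    where
    R∸m≤K : R ∸ m ≤ K
    R∸m≤K = subst (R ∸ m ≤_) (m+n∸n≡m K (suc K))
              (∸-mono (≤-trans (m≤m*n R t ⦃ >-nonZero t≥1 ⦄) (m≤m/2+[1+m/2] (R * t))) (≰⇒> m≰K))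
    N∸[R∸m]≡ : doobN r t ∸ ((R ∸ m) * t + 1) ≡ m * t + 1
    N∸[R∸m]≡ = trans (m*t+2∸[n*t+1]≡[m∸n]*t+1 t (m∸n≤m R m)) (cong (λ k → k * t + 1) (m∸[m∸n]≡n m≤R))

doobAdj⇔oneMod : ∀ r {t} {i j : Fin (doobN r t)} → 1 ≤ t → DoobAdj r t i j ⇔ OneMod t ∣ toℕ i - toℕ j ∣
doobAdj⇔oneMod r t≥1 = mk⇔ (doobAdj⇒oneMod r t≥1) (oneMod⇒doobAdj r t≥1)

y≤t∧oneMod[t∸y]⇒y≡t∸1 : ∀ {t y} → y ≤ t → OneMod t (t ∸ y) → y ≡ t ∸ 1
y≤t∧oneMod[t∸y]⇒y≡t∸1 {t} {y} y≤t (zero , t∸y≡1) = trans (sym (m∸[m∸n]≡n y≤t)) (cong (t ∸_) t∸y≡1)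
y≤t∧oneMod[t∸y]⇒y≡t∸1 {t} {y} y≤t (suc m , t∸y≡) =
  contradiction (subst (t <_) (sym t∸y≡) (≤-<-trans (m≤m+n t (m * t)) (m<m+n (t + m * t) z<s))) (≤⇒≯ (m∸n≤m t y))

1≢t∸1 : ∀ {t} → 1 ≤ t → t ≢ 2 → 1 ≢ t ∸ 1
1≢t∸1 {t} t≥1 t≢2 1≡t∸1 = t≢2 (trans (sym (m∸n+n≡m t≥1)) (cong (_+ 1) (sym 1≡t∸1)))

¬oneMod[t∸1] : ∀ {t} → 1 ≤ t → t ≢ 2 → ¬ OneMod t (t ∸ 1)
¬oneMod[t∸1] t≥1 t≢2 = 1≢t∸1 t≥1 t≢2 ∘ y≤t∧oneMod[t∸y]⇒y≡t∸1 t≥1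

oneMod⇔oneMod∣t-∣ : ∀ {t y} → y ≢ 1 → y ≢ t ∸ 1 → OneMod t y ⇔ OneMod t ∣ t - y ∣
oneMod⇔oneMod∣t-∣ {t} {y} y≢1 y≢t∸1 = mk⇔ shift unshift
  where
  shift : OneMod t y → OneMod t ∣ t - y ∣
  shift (zero  , y≡1) = contradiction y≡1 y≢1
  shift (suc m , refl) = m , trans (cong (λ z → ∣ t - z ∣) (+-assoc t (m * t) 1)) (∣m-m+n∣≡n t (m * t + 1))
  unshift : OneMod t ∣ t - y ∣ → OneMod t y
  unshift (m , d≡) with ≤-total y t
  ... | inj₁ y≤t =
    contradiction (y≤t∧oneMod[t∸y]⇒y≡t∸1 y≤t (m , trans (sym (m≤n⇒∣n-m∣≡n∸m y≤t)) d≡)) y≢t∸1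
  ... | inj₂ t≤y = suc m , (begin
    y              ≡⟨ m∸n+n≡m t≤y ⟨
    y ∸ t + t      ≡⟨ cong (_+ t) (trans (sym (m≤n⇒∣m-n∣≡n∸m t≤y)) d≡) ⟩
    m * t + 1 + t  ≡⟨ solve 2 (λ m t → m :* t :+ con 1 :+ t := (t :+ m :* t) :+ con 1) refl m t ⟩
    suc m * t + 1  ∎)
    where open ≡-Reasoning

module _ {r t : ℕ} (r≥2 : 2 ≤ r) (t≥1 : 1 ≤ t) where

  vertex : ∀ k → k ≤ t → Fin (doobN r t)
  vertex k k≤t = fromℕ< (≤-<-trans k≤t (≤-<-trans t≤R*t (m<m+n (R * t) z<s)))
    where
    R : ℕ
    R = r ∸ 1
    t≤R*t : t ≤ R * t
    t≤R*t = m≤n*m t R ⦃ >-nonZero (∸-monoˡ-≤ 1 r≥2) ⦄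

  toℕ-vertex : ∀ k (k≤t : k ≤ t) → toℕ (vertex k k≤t) ≡ k
  toℕ-vertex k k≤t = toℕ-fromℕ< _

  private
    t∸1≤t : t ∸ 1 ≤ t
    t∸1≤t = m∸n≤m t 1

  x₀ x₁ xₜ₋₁ xₜ : Fin (doobN r t)
  x₀   = vertex 0 z≤n
  x₁   = vertex 1 t≥1
  xₜ₋₁ = vertex (t ∸ 1) t∸1≤t
  xₜ   = vertex t ≤-refl

  private
    adj-x₀ : ∀ y → DoobAdj r t x₀ y ⇔ OneMod t (toℕ y)
    adj-x₀ y = subst (λ c → DoobAdj r t x₀ y ⇔ OneMod t ∣ c - toℕ y ∣)
                     (toℕ-vertex 0 z≤n) (doobAdj⇔oneMod r t≥1)

    adj-xₜ : ∀ y → DoobAdj r t xₜ y ⇔ OneMod t ∣ t - toℕ y ∣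
    adj-xₜ y = subst (λ c → DoobAdj r t xₜ y ⇔ OneMod t ∣ c - toℕ y ∣)
                     (toℕ-vertex t ≤-refl) (doobAdj⇔oneMod r t≥1)

    ∣t-x₁∣≡t∸1 : ∣ t - toℕ x₁ ∣ ≡ t ∸ 1
    ∣t-x₁∣≡t∸1 = trans (cong (λ c → ∣ t - c ∣) (toℕ-vertex 1 t≥1)) (m≤n⇒∣n-m∣≡n∸m t≥1)

    ∣t-xₜ₋₁∣≡1 : ∣ t - toℕ xₜ₋₁ ∣ ≡ 1
    ∣t-xₜ₋₁∣≡1 = begin
      ∣ t - toℕ xₜ₋₁ ∣  ≡⟨ cong (λ c → ∣ t - c ∣) (toℕ-vertex (t ∸ 1) t∸1≤t) ⟩
      ∣ t - (t ∸ 1) ∣   ≡⟨ m≤n⇒∣n-m∣≡n∸m t∸1≤t ⟩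
      t ∸ (t ∸ 1)       ≡⟨ m∸[m∸n]≡n t≥1 ⟩
      1                 ∎
      where open ≡-Reasoning

  x₀-xₜ-agree-elsewhere : ∀ y → y ≢ x₁ → y ≢ xₜ₋₁ → DoobAdj r t x₀ y ⇔ DoobAdj r t xₜ y
  x₀-xₜ-agree-elsewhere y y≢x₁ y≢xₜ₋₁ =
    ⇔-sym (adj-xₜ y) ⇔-∘ (oneMod⇔oneMod∣t-∣ (≢-toℕ 1 t≥1 y≢x₁) (≢-toℕ (t ∸ 1) t∸1≤t y≢xₜ₋₁)
                          ⇔-∘ adj-x₀ y)
    where
    ≢-toℕ : ∀ k (k≤t : k ≤ t) → y ≢ vertex k k≤t → toℕ y ≢ k
    ≢-toℕ k k≤t y≢v toℕy≡k = y≢v (toℕ-injective (trans toℕy≡k (sym (toℕ-vertex k k≤t))))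

  module _ (t≢2 : t ≢ 2) where

    x₁≢xₜ₋₁ : x₁ ≢ xₜ₋₁
    x₁≢xₜ₋₁ x₁≡xₜ₋₁ = 1≢t∸1 t≥1 t≢2 (begin
      1              ≡⟨ toℕ-vertex 1 t≥1 ⟨
      toℕ x₁         ≡⟨ cong toℕ x₁≡xₜ₋₁ ⟩
      toℕ xₜ₋₁       ≡⟨ toℕ-vertex (t ∸ 1) t∸1≤t ⟩
      t ∸ 1          ∎)
      where open ≡-Reasoning

    x₁-separates-x₀-xₜ : ExactlyOne (DoobAdj r t x₀ x₁) (DoobAdj r t xₜ x₁)
    x₁-separates-x₀-xₜ = inj₁ (Equivalence.from (adj-x₀ x₁) (0 , toℕ-vertex 1 t≥1) , ¬xₜ~x₁)
      where
      ¬xₜ~x₁ : ¬ DoobAdj r t xₜ x₁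
      ¬xₜ~x₁ = ¬oneMod[t∸1] t≥1 t≢2 ∘ subst (OneMod t) ∣t-x₁∣≡t∸1 ∘ Equivalence.to (adj-xₜ x₁)

    xₜ₋₁-separates-x₀-xₜ : ExactlyOne (DoobAdj r t x₀ xₜ₋₁) (DoobAdj r t xₜ xₜ₋₁)
    xₜ₋₁-separates-x₀-xₜ = inj₂ (¬x₀~xₜ₋₁ , Equivalence.from (adj-xₜ xₜ₋₁) (0 , ∣t-xₜ₋₁∣≡1))
      where
      ¬x₀~xₜ₋₁ : ¬ DoobAdj r t x₀ xₜ₋₁
      ¬x₀~xₜ₋₁ = ¬oneMod[t∸1] t≥1 t≢2 ∘ subst (OneMod t) (toℕ-vertex (t ∸ 1) t∸1≤t)
                 ∘ Equivalence.to (adj-x₀ xₜ₋₁)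

    neighbourSums-vanish⇒ℓx₁≡ℓxₜ₋₁ : ∀ {p} (ℓ : Fin (doobN r t) → Z2^ p) →
      (∀ x → neighbourSum (DoobAdj r t) (doobAdj? r t) ℓ x ≡ 𝟘) → ℓ x₁ ≡ ℓ xₜ₋₁
    neighbourSums-vanish⇒ℓx₁≡ℓxₜ₋₁ ℓ magic =
      neighbourSums-vanish⇒ℓ-collide (DoobAdj r t) (doobAdj? r t) ℓ magic
        x₁≢xₜ₋₁ x₁-separates-x₀-xₜ xₜ₋₁-separates-x₀-xₜ x₀-xₜ-agree-elsewhere

odd⇒≥1 : ∀ {t} → t % 2 ≡ 1 → 1 ≤ t
odd⇒≥1 {suc _} _ = s≤s z≤n

odd⇒≢2 : ∀ {t} → t % 2 ≡ 1 → t ≢ 2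
odd⇒≢2 () refl

corollary4 : (r t : ℕ) → r % 2 ≡ 1 → t % 2 ≡ 1 → 2 ≤ r →
    gcd (+ r) (+ t - + 2) ≡ + 1 →
    ¬ OpenXORMagic (DoobAdj r t) (doobAdj? r t)
corollary4 r t _ t-odd r≥2 _ (_ , _ , _ , _ , ℓ , (ℓ-injective , _) , magic) =
  x₁≢xₜ₋₁ r≥2 t≥1 t≢2 (ℓ-injective (neighbourSums-vanish⇒ℓx₁≡ℓxₜ₋₁ r≥2 t≥1 t≢2 ℓ magic))
  where
  t≥1 : 1 ≤ t
  t≥1 = odd⇒≥1 t-odd
  t≢2 : t ≢ 2
  t≢2 = odd⇒≢2 t-odd
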